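{- Let $p$ be an odd prime, let $k$ be an integer with $0\le k\le p-1$, and let $n>1$ be an even integer. Consider $$f_{n,k}(x)=k\sum_{j\geq 0}\binom{n-1}{2j+1}(x^j-x^{j+1})+2\sum_{j\geq 0}\binom{n}{2j}x^j\in\mathbb{F}_p[x]$$ (coefficients reduced modulo $p$). Then $f_{n,k}(x)$ is self-reciprocal if and only if one of the following holds: (i) $k=0$; (ii) $k=2$ and $n\neq 2lp$ for every positive integer $l$.
   Context: $\mathbb{F}_p$ is the field with $p$ elements. Binomial coefficients $\binom{a}{b}$ are $0$ when $b>a$. A nonzero polynomial $f(x)$ of (actual) degree $d\ge 0$ is self-reciprocal if $x^d f(1/x)=f(x)$, i.e. writing $f(x)=\sum_{i=0}^d a_ix^i$ with $a_d\neq 0$, $a_i=a_{d-i}$ for all $0\le i\le d$; nonzero constants count as self-reciprocal. -}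

module Defs where

open import Data.Nat using (ℕ; zero; suc; _≤_; _<_; _∸_)
open import Data.Nat.Combinatorics using (_C_)
open import Data.Integer using (ℤ; +_; _-_)
import Data.Integer as ℤ
open import Data.Integer.Divisibility using (_∣_)
open import Data.Product using (Σ; _×_)
open import Relation.Nullary using (¬_)

-- Polynomials over F_p are represented by an integer coefficient sequence
-- a : ℕ → ℤ (coefficient of x^i is a i), read modulo p.

_≡_[mod_] : ℤ → ℤ → ℕ → Set
a ≡ b [mod p ] = (+ p) ∣ (a - b)

SelfReciprocal : ℕ → (ℕ → ℤ) → Set
SelfReciprocal p a =
  Σ ℕ λ d → (¬ (a d ≡ + 0 [mod p ]))
          × ((i : ℕ) → d < i → a i ≡ + 0 [mod p ])
          × ((i : ℕ) → i ≤ d → a i ≡ a (d ∸ i) [mod p ])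

-- Coefficient of x^i:
--   k * C(n-1,2i+1)                (from the x^j term with j = i)
-- - k * C(n-1,2(i-1)+1)  if i ≥ 1  (from the -x^{j+1} term with j = i-1)
-- + 2 * C(n,2i)
shiftedTerm : ℕ → ℕ → ℕ
shiftedTerm n zero    = 0
shiftedTerm n (suc j) = (n ∸ 1) C (suc (2 Data.Nat.* j))

fCoeff : ℕ → ℕ → ℕ → ℤ
fCoeff n k i =
  (+ (k Data.Nat.* ((n ∸ 1) C (suc (2 Data.Nat.* i)))))
  - (+ (k Data.Nat.* shiftedTerm n i))
  ℤ.+ (+ (2 Data.Nat.* (n C (2 Data.Nat.* i))))

-- Write (1 + √x)ⁿ = E(x) + √x·O(x). Pascal's rule turns f_{n,k} into k·O + (2 − k)·E, and for
-- n = 2m the polynomial E is a palindrome of degree m with E(0) = E(m) = 1, while O is a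
-- palindrome of degree m − 1 with constant and leading coefficient n. For k = 0 and k = 2 only
-- one part survives: 2E is always self-reciprocal, and 2O is unless p ∣ n, when its constant
-- term vanishes. For any other k the coefficient 2 − k of xᵐ is a unit mod p, so f must be
-- palindromic about m/2; removing the palindrome (2 − k)·E and cancelling the unit k makes O
-- symmetric about both m/2 and (m − 1)/2, hence constant mod p and equal to its coefficient
-- O_m = 0. But the coefficients of O sum to 2ⁿ⁻¹, which the odd prime p does not divide.

module Submission where

open import Defs
open import Data.Nat using (ℕ; _≤_; _<_; _∸_; _*_)
open import Data.Nat.Divisibility using (_∣_)
open import Data.Nat.Primality using (Prime)
open import Data.Product using (_×_)
open import Data.Sum using (_⊎_)
open import Relation.Binary.PropositionalEquality using (_≡_; _≢_)
open import Relation.Nullary using (¬_)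
open import Function.Bundles using (_⇔_)

open import Algebra.Properties.CommutativeSemigroup using (interchange)
open import Data.Nat.Base using (zero; suc; _+_; _^_; z≤n; s≤s; z<s; nonTrivial⇒n>1)
open import Data.Nat.Properties
open import Data.Nat.Combinatorics
  using (_C_; nCk≡nC[n∸k]; nCn≡1; nC1≡n; nCk+nC[k+1]≡[n+1]C[k+1]; k>n⇒nCk≡0)
open import Data.Nat.Divisibility using (_∤_; divides; _∣0; ∣m∣n⇒∣m+n; ∣n⇒∣m*n; n∣m*n; >⇒∤)
open import Data.Nat.Primality using (euclidsLemma; prime⇒nonTrivial)
open import Data.Integer as ℤ using (ℤ; +_; ∣_∣)
import Data.Integer.Properties as ℤ
import Data.Integer.Divisibility as ℤ
import Data.Integer.Divisibility.Signed as ℤ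
  renaming (_∣_ to _∣ˢ_)
import Data.Integer.Tactic.RingSolver as ℤ-Solver
open import Data.Product using (_,_)
open import Data.Sum using (inj₁; inj₂; [_,_]′)
open import Function.Base using (id)
open import Relation.Binary.Definitions using (tri<; tri≈; tri>)
open import Relation.Binary.PropositionalEquality
  using (refl; sym; trans; cong; cong₂; subst; module ≡-Reasoning)
open import Relation.Nullary using (contradiction)
open import Function.Bundles using (mk⇔)

open ≡-Reasoning

≡⇒≡-mod : ∀ {p a b} → a ≡ b → a ≡ b [mod p ]
≡⇒≡-mod {p} {a} refl = subst (λ z → (+ p) ℤ.∣ z) (sym (ℤ.+-inverseʳ a)) (p ∣0)

≡-mod-sym : ∀ {p} a b → a ≡ b [mod p ] → b ≡ a [mod p ]
≡-mod-sym {p} a b a≡b =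
  subst (p ∣_) (trans (sym (ℤ.∣-i∣≡∣i∣ (a ℤ.- b))) (cong ∣_∣ (negate a b))) a≡b
  where
  negate : ∀ a b → ℤ.- (a ℤ.- b) ≡ b ℤ.- a
  negate = ℤ-Solver.solve-∀

≡-mod-trans : ∀ {p} a b c → a ≡ b [mod p ] → b ≡ c [mod p ] → a ≡ c [mod p ]
≡-mod-trans {p} a b c a≡b b≡c =
  ℤ.∣⇒∣ᵤ (subst (+ p ℤ.∣ˢ_) (telescope a b c)
    (ℤ.∣m∣n⇒∣m+n (ℤ.∣ᵤ⇒∣ {i = a ℤ.- b} a≡b) (ℤ.∣ᵤ⇒∣ {i = b ℤ.- c} b≡c)))
  where
  telescope : ∀ a b c → a ℤ.- b ℤ.+ (b ℤ.- c) ≡ a ℤ.- c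
  telescope = ℤ-Solver.solve-∀

≡-mod-0⇒∣ : ∀ {p x} → (+ x) ≡ + 0 [mod p ] → p ∣ x
≡-mod-0⇒∣ {p} {x} = subst (p ∣_) (+-identityʳ x)

∣⇒≡-mod-0 : ∀ {p x} → p ∣ x → (+ x) ≡ + 0 [mod p ]
∣⇒≡-mod-0 {p} {x} = subst (p ∣_) (sym (+-identityʳ x))

∣*-cancelˡ-prime : ∀ {p k} z → Prime p → p ∤ k → (+ p) ℤ.∣ (+ k ℤ.* z) → (+ p) ℤ.∣ z
∣*-cancelˡ-prime {p} {k} z p-prime p∤k p∣kz =
  [ (λ p∣k → contradiction p∣k p∤k) , id ]′
    (euclidsLemma k ∣ z ∣ p-prime (subst (p ∣_) (ℤ.abs-* (+ k) z) p∣kz))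

oddPrime⇒2<p : ∀ {p} → Prime p → p ≢ 2 → 2 < p
oddPrime⇒2<p {p} p-prime p≢2 =
  ≤∧≢⇒< (nonTrivial⇒n>1 p {{prime⇒nonTrivial p-prime}}) (λ 2≡p → p≢2 (sym 2≡p))

≤∸1⇒< : ∀ {k n} → 0 < n → k ≤ n ∸ 1 → k < n
≤∸1⇒< {n = suc _} _ k≤n∸1 = s≤s k≤n∸1

prime∤2⇒∤2^ : ∀ {p} → Prime p → p ∤ 2 → ∀ e → p ∤ 2 ^ e
prime∤2⇒∤2^ {p} p-prime p∤2 zero    = >⇒∤ (nonTrivial⇒n>1 p {{prime⇒nonTrivial p-prime}})
prime∤2⇒∤2^     p-prime p∤2 (suc e) p∣2^1+e =
  [ p∤2 , prime∤2⇒∤2^ p-prime p∤2 e ]′ (euclidsLemma 2 (2 ^ e) p-prime p∣2^1+e)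

Palindromic : ℕ → (ℕ → ℤ) → ℕ → Set
Palindromic p a m = ∀ i → i ≤ m → a i ≡ a (m ∸ i) [mod p ]

selfReciprocal⇒palindromic : ∀ {p} a m → ¬ a m ≡ + 0 [mod p ] →
  (∀ i → m < i → a i ≡ + 0 [mod p ]) → SelfReciprocal p a → Palindromic p a m
selfReciprocal⇒palindromic a m aₘ≢0 vanish (d , a_d≢0 , vanish-d , palindromic) with <-cmp d m
... | tri< d<m _ _ = contradiction (vanish-d m d<m) aₘ≢0
... | tri≈ _ refl _ = palindromic
... | tri> _ _ m<d = contradiction (vanish d m<d) a_d≢0

selfReciprocal⇒a₀≢0 : ∀ {p} a → SelfReciprocal p a → ¬ a 0 ≡ + 0 [mod p ]
selfReciprocal⇒a₀≢0 a (d , a_d≢0 , _ , palindromic) a₀≡0 =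
  a_d≢0 (≡-mod-trans (a d) (a 0) (+ 0) (≡-mod-sym (a 0) (a d) (palindromic 0 z≤n)) a₀≡0)

selfReciprocal-fromℕ : ∀ {p} a (b : ℕ → ℕ) m → (∀ i → a i ≡ + b i) → p ∤ b m →
  (∀ i → m < i → b i ≡ 0) → (∀ i → i ≤ m → b i ≡ b (m ∸ i)) → SelfReciprocal p a
selfReciprocal-fromℕ {p} a b m a≡b p∤bₘ vanish reflect =
  m , (λ aₘ≡0 → p∤bₘ (≡-mod-0⇒∣ (subst (λ z → z ≡ + 0 [mod p ]) (a≡b m) aₘ≡0)))
    , (λ i m<i → ≡⇒≡-mod (trans (a≡b i) (cong +_ (vanish i m<i))))
    , (λ i i≤m → ≡⇒≡-mod (trans (a≡b i) (trans (cong +_ (reflect i i≤m)) (sym (a≡b (m ∸ i))))))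

-- Symmetry about t/2 and about (t+1)/2 together give b (j + 1) ≡ b (t - j) ≡ b j.
palindromic²⇒constant : ∀ {p} b t → Palindromic p b t → Palindromic p b (suc t) →
  ∀ i → i ≤ suc t → b i ≡ b 0 [mod p ]
palindromic²⇒constant b t pal pal₁ zero    _         = ≡⇒≡-mod {a = b 0} refl
palindromic²⇒constant b t pal pal₁ (suc j) (s≤s j≤t) =
  ≡-mod-trans (b (suc j)) (b (t ∸ j)) (b 0) (pal₁ (suc j) (s≤s j≤t))
    (≡-mod-trans (b (t ∸ j)) (b j) (b 0) (≡-mod-sym (b j) (b (t ∸ j)) (pal j j≤t))
      (palindromic²⇒constant b t pal pal₁ j (m≤n⇒m≤1+n j≤t)))

-- As coefficient sequences, (1 + √x)ⁿ = evenPart n (x) + √x · oddPart n (x).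
evenPart oddPart : ℕ → ℕ → ℕ
evenPart n i = n C (2 * i)
oddPart  n i = n C suc (2 * i)

sumBelow : (ℕ → ℕ) → ℕ → ℕ
sumBelow f zero    = 0
sumBelow f (suc s) = sumBelow f s + f s

sumBelow-∣ : ∀ {d} f s → (∀ i → i < s → d ∣ f i) → d ∣ sumBelow f s
sumBelow-∣ {d} f zero    _   = d ∣0
sumBelow-∣     f (suc s) d∣f =
  ∣m∣n⇒∣m+n (sumBelow-∣ f s (λ i i<s → d∣f i (m<n⇒m<1+n i<s))) (d∣f s (n<1+n s))

sumBelow-pascal : ∀ N s → sumBelow (suc N C_) (suc s) ≡ sumBelow (N C_) s + sumBelow (N C_) (suc s)
sumBelow-pascal N zero    = refl
sumBelow-pascal N (suc s) = begin
  sumBelow (suc N C_) (suc s) + suc N C suc s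
    ≡⟨ cong₂ _+_ (sumBelow-pascal N s) (sym (nCk+nC[k+1]≡[n+1]C[k+1] N s)) ⟩
  (sumBelow (N C_) s + sumBelow (N C_) (suc s)) + (N C s + N C suc s)
    ≡⟨ interchange +-commutativeSemigroup
         (sumBelow (N C_) s) (sumBelow (N C_) (suc s)) (N C s) (N C suc s) ⟩
  (sumBelow (N C_) s + N C s) + (sumBelow (N C_) (suc s) + N C suc s) ∎

binomial-sum : ∀ N → sumBelow (N C_) (suc N) ≡ 2 ^ N
binomial-sum zero    = refl
binomial-sum (suc N) = begin
  sumBelow (suc N C_) (suc (suc N))  ≡⟨ sumBelow-pascal N (suc N) ⟩
  S + (S + N C suc N)                ≡⟨ cong (λ c → S + (S + c)) (k>n⇒nCk≡0 (n<1+n N)) ⟩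
  S + (S + 0)                        ≡⟨ cong (λ x → x + (x + 0)) (binomial-sum N) ⟩
  2 ^ suc N                          ∎
  where S = sumBelow (N C_) (suc N)

oddPart-sum-pascal : ∀ N s → sumBelow (oddPart (suc N)) s ≡ sumBelow (N C_) (2 * s)
oddPart-sum-pascal N zero    = refl
oddPart-sum-pascal N (suc s) = begin
  sumBelow (oddPart (suc N)) s + oddPart (suc N) s
    ≡⟨ cong₂ _+_ (oddPart-sum-pascal N s) (sym (nCk+nC[k+1]≡[n+1]C[k+1] N (2 * s))) ⟩
  sumBelow (N C_) (2 * s) + (N C (2 * s) + N C suc (2 * s))
    ≡⟨ sym (+-assoc (sumBelow (N C_) (2 * s)) (N C (2 * s)) (N C suc (2 * s))) ⟩
  sumBelow (N C_) (suc (suc (2 * s)))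
    ≡⟨ cong (sumBelow (N C_)) (sym (*-suc 2 s)) ⟩
  sumBelow (N C_) (2 * suc s) ∎

C-reflect : ∀ {N} a b → a + b ≡ N → N C a ≡ N C b
C-reflect a b refl = trans (nCk≡nC[n∸k] (m≤m+n a b)) (cong ((a + b) C_) (m+n∸m≡n a b))

double-split : ∀ {m i} → i ≤ m → 2 * i + 2 * (m ∸ i) ≡ m * 2
double-split {m} {i} i≤m = begin
  2 * i + 2 * (m ∸ i)  ≡⟨ sym (*-distribˡ-+ 2 i (m ∸ i)) ⟩
  2 * (i + (m ∸ i))    ≡⟨ cong (2 *_) (m+[n∸m]≡n i≤m) ⟩
  2 * m                ≡⟨ *-comm 2 m ⟩
  m * 2                ∎

evenPart-reflect : ∀ m i → i ≤ m → evenPart (m * 2) i ≡ evenPart (m * 2) (m ∸ i)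
evenPart-reflect m i i≤m = C-reflect (2 * i) (2 * (m ∸ i)) (double-split i≤m)

oddPart-reflect : ∀ t i → i ≤ t → oddPart (suc t * 2) i ≡ oddPart (suc t * 2) (t ∸ i)
oddPart-reflect t i i≤t =
  C-reflect (suc (2 * i)) (suc (2 * (t ∸ i)))
    (cong suc (trans (+-suc (2 * i) (2 * (t ∸ i))) (cong suc (double-split i≤t))))

evenPart-vanish : ∀ m i → m < i → evenPart (m * 2) i ≡ 0
evenPart-vanish m i m<i = k>n⇒nCk≡0 (subst (m * 2 <_) (*-comm i 2) (*-monoˡ-< 2 m<i))

oddPart-vanish : ∀ m i → m ≤ i → oddPart (m * 2) i ≡ 0
oddPart-vanish m i m≤i = k>n⇒nCk≡0 (s≤s (subst (m * 2 ≤_) (*-comm i 2) (*-monoˡ-≤ 2 m≤i)))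

evenPart-top : ∀ m → evenPart (m * 2) m ≡ 1
evenPart-top m = trans (cong ((m * 2) C_) (*-comm 2 m)) (nCn≡1 (m * 2))

oddPart-top : ∀ t → oddPart (suc t * 2) t ≡ suc t * 2
oddPart-top t = begin
  oddPart (suc t * 2) t        ≡⟨ oddPart-reflect t t ≤-refl ⟩
  oddPart (suc t * 2) (t ∸ t)  ≡⟨ cong (oddPart (suc t * 2)) (n∸n≡0 t) ⟩
  suc t * 2 C 1                ≡⟨ nC1≡n (suc t * 2) ⟩
  suc t * 2                    ∎

oddPart-sum : ∀ t → sumBelow (oddPart (suc t * 2)) (suc t) ≡ 2 ^ suc (t * 2)
oddPart-sum t = begin
  sumBelow (oddPart (suc t * 2)) (suc t)    ≡⟨ oddPart-sum-pascal N (suc t) ⟩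
  sumBelow (N C_) (2 * suc t)               ≡⟨ cong (sumBelow (N C_)) (*-comm 2 (suc t)) ⟩
  sumBelow (N C_) (suc N)                   ≡⟨ binomial-sum N ⟩
  2 ^ N                                     ∎
  where N = suc (t * 2)

shiftedTerm-pascal : ∀ N i → suc N C (2 * i) ≡ N C (2 * i) + shiftedTerm (suc N) i
shiftedTerm-pascal N zero    = refl
shiftedTerm-pascal N (suc j) = begin
  suc N C (2 * suc j)                          ≡⟨ cong (suc N C_) (*-suc 2 j) ⟩
  suc N C suc (suc (2 * j))                    ≡⟨ sym (nCk+nC[k+1]≡[n+1]C[k+1] N (suc (2 * j))) ⟩
  N C suc (2 * j) + N C suc (suc (2 * j))      ≡⟨ +-comm (N C suc (2 * j)) _ ⟩
  N C suc (suc (2 * j)) + N C suc (2 * j)      ≡⟨ cong (λ c → N C c + N C suc (2 * j)) (sym (*-suc 2 j)) ⟩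
  N C (2 * suc j) + shiftedTerm (suc N) (suc j) ∎

fCoeff-decomposition : ∀ N k i →
  fCoeff (suc N) k i ≡ + k ℤ.* + oddPart (suc N) i ℤ.+ (+ 2 ℤ.- + k) ℤ.* + evenPart (suc N) i
fCoeff-decomposition N k i = begin
  fCoeff (suc N) k i
    ≡⟨ cong₂ ℤ._+_ (cong₂ ℤ._-_ (ℤ.pos-* k X) (ℤ.pos-* k B))
                   (trans (cong (λ c → + (2 * c)) (shiftedTerm-pascal N i)) (ℤ.pos-* 2 (A + B))) ⟩
  + k ℤ.* + X ℤ.- + k ℤ.* + B ℤ.+ + 2 ℤ.* + (A + B)
    ≡⟨ cong (λ c → + k ℤ.* + X ℤ.- + k ℤ.* + B ℤ.+ + 2 ℤ.* c) (ℤ.pos-+ A B) ⟩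
  + k ℤ.* + X ℤ.- + k ℤ.* + B ℤ.+ + 2 ℤ.* (+ A ℤ.+ + B)
    ≡⟨ regroup (+ k) (+ A) (+ B) (+ X) ⟩
  + k ℤ.* (+ A ℤ.+ + X) ℤ.+ (+ 2 ℤ.- + k) ℤ.* (+ A ℤ.+ + B)
    ≡⟨ cong₂ (λ o e → + k ℤ.* o ℤ.+ (+ 2 ℤ.- + k) ℤ.* e)
             (trans (sym (ℤ.pos-+ A X)) (cong +_ (nCk+nC[k+1]≡[n+1]C[k+1] N (2 * i))))
             (trans (sym (ℤ.pos-+ A B)) (cong +_ (sym (shiftedTerm-pascal N i)))) ⟩
  + k ℤ.* + oddPart (suc N) i ℤ.+ (+ 2 ℤ.- + k) ℤ.* + evenPart (suc N) i ∎
  where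
  A = N C (2 * i)
  B = shiftedTerm (suc N) i
  X = N C suc (2 * i)
  regroup : ∀ c a b x → c ℤ.* x ℤ.- c ℤ.* b ℤ.+ + 2 ℤ.* (a ℤ.+ b)
                      ≡ c ℤ.* (a ℤ.+ x) ℤ.+ (+ 2 ℤ.- c) ℤ.* (a ℤ.+ b)
  regroup = ℤ-Solver.solve-∀

fCoeff-k≡0 : ∀ N i → fCoeff (suc N) 0 i ≡ + (2 * evenPart (suc N) i)
fCoeff-k≡0 N i = trans (fCoeff-decomposition N 0 i)
  (trans (simplify (+ oddPart (suc N) i) (+ evenPart (suc N) i)) (sym (ℤ.pos-* 2 (evenPart (suc N) i))))
  where
  simplify : ∀ o e → + 0 ℤ.* o ℤ.+ (+ 2 ℤ.- + 0) ℤ.* e ≡ + 2 ℤ.* e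
  simplify = ℤ-Solver.solve-∀

fCoeff-k≡2 : ∀ N i → fCoeff (suc N) 2 i ≡ + (2 * oddPart (suc N) i)
fCoeff-k≡2 N i = trans (fCoeff-decomposition N 2 i)
  (trans (simplify (+ oddPart (suc N) i) (+ evenPart (suc N) i)) (sym (ℤ.pos-* 2 (oddPart (suc N) i))))
  where
  simplify : ∀ o e → + 2 ℤ.* o ℤ.+ (+ 2 ℤ.- + 2) ℤ.* e ≡ + 2 ℤ.* o
  simplify = ℤ-Solver.solve-∀

fCoeff-difference : ∀ N k i j → evenPart (suc N) i ≡ evenPart (suc N) j →
  fCoeff (suc N) k i ℤ.- fCoeff (suc N) k j ≡ + k ℤ.* (+ oddPart (suc N) i ℤ.- + oddPart (suc N) j)
fCoeff-difference N k i j Eᵢ≡Eⱼ = begin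
  fCoeff (suc N) k i ℤ.- fCoeff (suc N) k j
    ≡⟨ cong₂ ℤ._-_ (fCoeff-decomposition N k i)
                   (trans (fCoeff-decomposition N k j)
                          (cong (λ e → K ℤ.* Oⱼ ℤ.+ (+ 2 ℤ.- K) ℤ.* + e) (sym Eᵢ≡Eⱼ))) ⟩
  K ℤ.* Oᵢ ℤ.+ (+ 2 ℤ.- K) ℤ.* Eᵢ ℤ.- (K ℤ.* Oⱼ ℤ.+ (+ 2 ℤ.- K) ℤ.* Eᵢ)
    ≡⟨ cancel K Oᵢ Oⱼ Eᵢ ⟩
  K ℤ.* (Oᵢ ℤ.- Oⱼ) ∎
  where
  K  = + k
  Oᵢ = + oddPart (suc N) i
  Oⱼ = + oddPart (suc N) j
  Eᵢ = + evenPart (suc N) i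
  cancel : ∀ c x y e → c ℤ.* x ℤ.+ (+ 2 ℤ.- c) ℤ.* e ℤ.- (c ℤ.* y ℤ.+ (+ 2 ℤ.- c) ℤ.* e)
                     ≡ c ℤ.* (x ℤ.- y)
  cancel = ℤ-Solver.solve-∀

fCoeff-top : ∀ t k → fCoeff (suc t * 2) k (suc t) ≡ + 2 ℤ.- + k
fCoeff-top t k = begin
  fCoeff (suc t * 2) k (suc t)
    ≡⟨ fCoeff-decomposition (suc (t * 2)) k (suc t) ⟩
  + k ℤ.* + oddPart (suc t * 2) (suc t) ℤ.+ (+ 2 ℤ.- + k) ℤ.* + evenPart (suc t * 2) (suc t)
    ≡⟨ cong₂ (λ o e → + k ℤ.* + o ℤ.+ (+ 2 ℤ.- + k) ℤ.* + e)
             (oddPart-vanish (suc t) (suc t) ≤-refl) (evenPart-top (suc t)) ⟩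
  + k ℤ.* + 0 ℤ.+ (+ 2 ℤ.- + k) ℤ.* + 1
    ≡⟨ simplify (+ k) ⟩
  + 2 ℤ.- + k ∎
  where
  simplify : ∀ c → c ℤ.* + 0 ℤ.+ (+ 2 ℤ.- c) ℤ.* + 1 ≡ + 2 ℤ.- c
  simplify = ℤ-Solver.solve-∀

fCoeff-vanish : ∀ t k i → suc t < i → fCoeff (suc t * 2) k i ≡ + 0
fCoeff-vanish t k i 1+t<i = begin
  fCoeff (suc t * 2) k i
    ≡⟨ fCoeff-decomposition (suc (t * 2)) k i ⟩
  + k ℤ.* + oddPart (suc t * 2) i ℤ.+ (+ 2 ℤ.- + k) ℤ.* + evenPart (suc t * 2) i
    ≡⟨ cong₂ (λ o e → + k ℤ.* + o ℤ.+ (+ 2 ℤ.- + k) ℤ.* + e)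
             (oddPart-vanish (suc t) i (<⇒≤ 1+t<i)) (evenPart-vanish (suc t) i 1+t<i) ⟩
  + k ℤ.* + 0 ℤ.+ (+ 2 ℤ.- + k) ℤ.* + 0
    ≡⟨ simplify (+ k) ⟩
  + 0 ∎
  where
  simplify : ∀ c → c ℤ.* + 0 ℤ.+ (+ 2 ℤ.- c) ℤ.* + 0 ≡ + 0
  simplify = ℤ-Solver.solve-∀

fCoeff-¬selfReciprocal : ∀ {p k} t → Prime p → p ∤ 2 →
  p ∤ k → ¬ (+ 2 ℤ.- + k) ≡ + 0 [mod p ] → ¬ SelfReciprocal p (fCoeff (suc t * 2) k)
fCoeff-¬selfReciprocal {p} {k} t p-prime p∤2 p∤k 2-k≢0 sr =
  prime∤2⇒∤2^ p-prime p∤2 (suc (t * 2))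
    (subst (p ∣_) (oddPart-sum t)
      (sumBelow-∣ O (suc t) (λ i i<1+t → ≡-mod-0⇒∣ (O≡0 i (<⇒≤ i<1+t)))))
  where
  O = oddPart (suc t * 2)
  fCoeff-palindromic : Palindromic p (fCoeff (suc t * 2) k) (suc t)
  fCoeff-palindromic = selfReciprocal⇒palindromic (fCoeff (suc t * 2) k) (suc t)
    (λ top≡0 → 2-k≢0 (subst (λ z → z ≡ + 0 [mod p ]) (fCoeff-top t k) top≡0))
    (λ i m<i → ≡⇒≡-mod (fCoeff-vanish t k i m<i)) sr
  -- The even part is exactly palindromic, so the symmetry of f is carried by k · O alone.
  O-palindromic : Palindromic p (λ i → + O i) (suc t)
  O-palindromic i i≤m = ∣*-cancelˡ-prime (+ O i ℤ.- + O (suc t ∸ i)) p-prime p∤k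
    (subst (λ z → (+ p) ℤ.∣ z)
      (fCoeff-difference (suc (t * 2)) k i (suc t ∸ i) (evenPart-reflect (suc t) i i≤m))
      (fCoeff-palindromic i i≤m))
  O-constant : ∀ i → i ≤ suc t → (+ O i) ≡ + O 0 [mod p ]
  O-constant = palindromic²⇒constant (λ i → + O i) t
    (λ i i≤t → ≡⇒≡-mod (cong +_ (oddPart-reflect t i i≤t))) O-palindromic
  O≡0 : ∀ i → i ≤ suc t → (+ O i) ≡ + 0 [mod p ]
  O≡0 i i≤m = ≡-mod-trans (+ O i) (+ O 0) (+ 0) (O-constant i i≤m)
    (subst (λ o → (+ O 0) ≡ + o [mod p ]) (oddPart-vanish (suc t) (suc t) ≤-refl)
      (≡-mod-sym (+ O (suc t)) (+ O 0) (O-constant (suc t) ≤-refl)))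

fCoeff-selfReciprocal⇒ : ∀ {p} k t → Prime p → p ∤ 2 → k < p →
  SelfReciprocal p (fCoeff (suc t * 2) k) →
  k ≡ 0 ⊎ (k ≡ 2 × ((l : ℕ) → 1 ≤ l → suc t * 2 ≢ 2 * l * p))
fCoeff-selfReciprocal⇒ zero t _ _ _ _ = inj₁ refl
fCoeff-selfReciprocal⇒ 1 t p-prime p∤2 1<p sr =
  contradiction sr (fCoeff-¬selfReciprocal t p-prime p∤2 (>⇒∤ 1<p) (>⇒∤ 1<p))
fCoeff-selfReciprocal⇒ {p} 2 t p-prime p∤2 _ sr =
  inj₂ (refl , λ l _ n≡2lp → selfReciprocal⇒a₀≢0 a sr (a₀≡0 l n≡2lp))
  where
  n = suc t * 2
  a = fCoeff n 2
  a₀≡0 : ∀ l → n ≡ 2 * l * p → a 0 ≡ + 0 [mod p ]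
  a₀≡0 l n≡2lp = subst (λ z → z ≡ + 0 [mod p ]) (sym (fCoeff-k≡2 (suc (t * 2)) 0))
    (∣⇒≡-mod-0 (∣n⇒∣m*n 2 (subst (p ∣_) (sym (trans (nC1≡n n) n≡2lp)) (n∣m*n (2 * l)))))
-- Here ∣ + 2 - + k ∣ computes to k ∸ 2, so the last argument is just p ∤ k ∸ 2.
fCoeff-selfReciprocal⇒ {p} k@(suc (suc (suc k-3))) t p-prime p∤2 k<p sr =
  contradiction sr (fCoeff-¬selfReciprocal t p-prime p∤2 (>⇒∤ k<p) (>⇒∤ k-2<p))
  where
  k-2<p : suc k-3 < p
  k-2<p = <-trans (n<1+n (suc k-3)) (<-trans (n<1+n (suc (suc k-3))) k<p)

fCoeff-selfReciprocal⇐ : ∀ {p k} t → Prime p → p ∤ 2 →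
  k ≡ 0 ⊎ (k ≡ 2 × ((l : ℕ) → 1 ≤ l → suc t * 2 ≢ 2 * l * p)) →
  SelfReciprocal p (fCoeff (suc t * 2) k)
fCoeff-selfReciprocal⇐ {p} t p-prime p∤2 (inj₁ refl) =
  selfReciprocal-fromℕ (fCoeff n 0) (λ i → 2 * evenPart n i) (suc t) (fCoeff-k≡0 (suc (t * 2)))
    (λ p∣2E → p∤2 (subst (p ∣_) (cong (2 *_) (evenPart-top (suc t))) p∣2E))
    (λ i m<i → cong (2 *_) (evenPart-vanish (suc t) i m<i))
    (λ i i≤m → cong (2 *_) (evenPart-reflect (suc t) i i≤m))
  where n = suc t * 2
fCoeff-selfReciprocal⇐ {p} t p-prime p∤2 (inj₂ (refl , n≢2lp)) =
  selfReciprocal-fromℕ (fCoeff n 2) (λ i → 2 * oddPart n i) t (fCoeff-k≡2 (suc (t * 2)))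
    (λ p∣2O → p∤2n (subst (p ∣_) (cong (2 *_) (oddPart-top t)) p∣2O))
    (λ i t<i → cong (2 *_) (oddPart-vanish (suc t) i t<i))
    (λ i i≤t → cong (2 *_) (oddPart-reflect t i i≤t))
  where
  n = suc t * 2
  p∤1+t : p ∤ suc t
  p∤1+t (divides (suc l) 1+t≡[1+l]p) = n≢2lp (suc l) (s≤s z≤n)
    (trans (cong (_* 2) 1+t≡[1+l]p) (trans (*-comm (suc l * p) 2) (sym (*-assoc 2 (suc l) p))))
  p∤2n : p ∤ 2 * n
  p∤2n p∣2n = [ p∤2 , (λ p∣n → [ p∤1+t , p∤2 ]′ (euclidsLemma (suc t) 2 p-prime p∣n)) ]′
    (euclidsLemma 2 n p-prime p∣2n)

theorem3p1 : (p k n : ℕ) → Prime p → p ≢ 2 → k ≤ p ∸ 1 → 1 < n → 2 ∣ n →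
    SelfReciprocal p (fCoeff n k)
    ⇔ (k ≡ 0 ⊎ (k ≡ 2 × ((l : ℕ) → 1 ≤ l → n ≢ 2 * l * p)))
theorem3p1 p k .(zero * 2) _ _ _ () (divides zero refl)
theorem3p1 p k .(suc t * 2) p-prime p≢2 k≤p∸1 _ (divides (suc t) refl) =
  mk⇔ (fCoeff-selfReciprocal⇒ k t p-prime p∤2 k<p) (fCoeff-selfReciprocal⇐ t p-prime p∤2)
  where
  2<p : 2 < p
  2<p = oddPrime⇒2<p p-prime p≢2
  p∤2 : p ∤ 2
  p∤2 = >⇒∤ 2<p
  k<p : k < p
  k<p = ≤∸1⇒< (<-trans z<s 2<p) k≤p∸1
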